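{- Let $a=(a_1,\dots,a_m)$ be a one-row descending plane partition of order $n$ with no special part, let $\gamma=(a_1,a_2-1,\dots,a_m-(m-1))$, and let $\beta=(\beta_1,\dots,\beta_{n-m})$ be $\{1,\dots,n\}\setminus\{\gamma_1,\dots,\gamma_m\}$ in decreasing order. Then: (1) $\beta_{n-m}=1$ if and only if $a_m>m$; and for $1<p<n$, $\beta_{n-m}=p$ if and only if $a_i=m$ for all $i>m-p+1$ and $a_{m-p+1}>m$. (2) $\beta_1=n$ if and only if $a_1<n$; for $0<p<m$, $\beta_1=n-p$ if and only if $a_i=n$ for all $i\le p$ and $a_{p+1}<n$; and $\beta_1=n-m$ if and only if $a_1=\dots=a_m=n$.
   Context: A one-row descending plane partition of order $n$ is a sequence $(a_1,\dots,a_m)$ of positive integers with $n\ge a_1\ge\dots\ge a_m$ and $a_1>m$; it has no special part if $a_j\ge j$ for all $j$. -}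

module Defs where

open import Data.Nat using (ℕ; zero; suc; _∸_; _≤_; _<_; _≥_; _≟_)
open import Data.Maybe using (Maybe; just; nothing)
open import Data.List using (List; []; _∷_; length; map; filter; downFrom)
open import Data.List.Relation.Unary.All using (All)
open import Data.List.Relation.Unary.Linked using (Linked)
open import Data.List.Membership.DecPropositional _≟_ using (_∉?_)
open import Data.Product using (Σ; _×_)
open import Relation.Binary.PropositionalEquality using (_≡_)

-- 1-based indexing into a list: xs ! i = just x_i if 1 ≤ i ≤ length xs,
-- nothing otherwise (in particular xs ! 0 = nothing).
_!_ : List ℕ → ℕ → Maybe ℕ
[] ! _ = nothing
(x ∷ xs) ! zero = nothing
(x ∷ xs) ! suc zero = just x
(x ∷ xs) ! suc (suc k) = xs ! suc k

record OneRowDPP (n : ℕ) (a : List ℕ) : Set where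
  field
    positive   : All (1 ≤_) a
    weaklyDecr : Linked _≥_ a
    first      : Σ ℕ λ x → (a ! 1 ≡ just x) × (x ≤ n) × (length a < x)

NoSpecialPart : List ℕ → Set
NoSpecialPart a = ∀ j x → a ! j ≡ just x → j ≤ x

gammaFrom : ℕ → List ℕ → List ℕ
gammaFrom k [] = []
gammaFrom k (x ∷ xs) = (x ∸ k) ∷ gammaFrom (suc k) xs

gamma : List ℕ → List ℕ
gamma a = gammaFrom 0 a

beta : ℕ → List ℕ → List ℕ
beta n a = filter (_∉? gamma a) (map suc (downFrom n))

-- Since a is weakly decreasing with a_j ≥ j, γ is strictly decreasing with entries in
-- {1,…,n}, so β has exactly n − m entries.  Splitting a = (n,…,n, rest) with c leading
-- copies of n and rest < n, γ begins with n, n − 1, …, n − c + 1 and its remaining entries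
-- are below n − c, so β₁ = n − c.  Splitting a = (front, m,…,m) with q trailing copies of
-- m and front > m, γ ends with q, …, 1 and its other entries exceed q + 1, so the last
-- entry of β is β_{n−m} = q + 1.  Both parts then reduce to reading c and q off the
-- conditions on a.
module Submission where

open import Defs
open import Data.Nat using (ℕ; zero; suc; _+_; _∸_; _≤_; _<_; _≥_; _>_; z≤n; s≤s; s≤s⁻¹)
open import Data.Nat.Properties
open import Data.Maybe using (Maybe; just)
open import Data.Maybe.Properties using (just-injective)
open import Data.List using (List; []; _∷_; length; _++_; map; filter; downFrom)
open import Data.List.Properties using (length-++; length-++-≤ˡ; length-++-sucʳ; ++-identityʳ; filter-accept; filter-reject; filter-none; filter-++)
open import Data.List.Relation.Unary.All as All using (All; []; _∷_)
open import Data.List.Relation.Unary.All.Properties using (++⁺; ++⁻ʳ)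
open import Data.List.Relation.Unary.Linked as Linked using (Linked; []; [-]; _∷_)
open import Data.List.Relation.Unary.Linked.Properties using (Linked⇒All)
open import Data.List.Relation.Unary.Any using (here; there)
open import Data.List.Membership.Propositional using (_∈_; _∉_)
open import Data.List.Membership.Propositional.Properties using (∈-map⁻; ∈-downFrom⁻; ∈-++⁺ˡ; ∈-++⁺ʳ; ∈-++⁻)
open import Data.List.Membership.DecPropositional _≟_ using (_∉?_; _∈?_)
open import Data.Product using (Σ; _×_; _,_; proj₂)
open import Data.Sum using (inj₁; inj₂)
open import Data.Unit using (⊤; tt)
open import Function.Base using (_∘_)
open import Function.Bundles using (_⇔_; mk⇔)
open import Function.Properties.Equivalence using () renaming (trans to ⇔-trans; sym to ⇔-sym)
open import Relation.Nullary using (Dec; yes; no; contradiction)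
open import Relation.Binary.PropositionalEquality using (_≡_; _≢_; refl; sym; trans; cong; cong₂; subst; module ≡-Reasoning)
open import Relation.Binary.Definitions using (tri<; tri≈; tri>)

just-≡⇔ : ∀ {mx : Maybe ℕ} {b p} → mx ≡ just b → (mx ≡ just p ⇔ b ≡ p)
just-≡⇔ refl = mk⇔ just-injective (cong just)

!-just⇒≤length : ∀ xs {i x} → xs ! i ≡ just x → i ≤ length xs
!-just⇒≤length (y ∷ ys) {suc zero}    _ = s≤s z≤n
!-just⇒≤length (y ∷ ys) {suc (suc i)} e = s≤s (!-just⇒≤length ys e)

!-zero : ∀ xs {x} → xs ! 0 ≢ just x
!-zero []      ()
!-zero (_ ∷ _) ()

!-defined : ∀ xs {i} → 0 < i → i ≤ length xs → Σ ℕ λ x → xs ! i ≡ just x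
!-defined (y ∷ ys) {suc zero}    _ _         = y , refl
!-defined (y ∷ ys) {suc (suc i)} _ (s≤s i≤) = !-defined ys (s≤s z≤n) i≤

!-∷ : ∀ {y} xs {i x} → xs ! i ≡ just x → (y ∷ xs) ! suc i ≡ just x
!-∷ (z ∷ zs) {suc i} e = e

!-last : ∀ xs y → (xs ++ y ∷ []) ! length (xs ++ y ∷ []) ≡ just y
!-last []           y = refl
!-last (x ∷ [])     y = refl
!-last (x ∷ x′ ∷ xs) y = !-last (x′ ∷ xs) y

All-! : ∀ {P : ℕ → Set} {xs i x} → All P xs → xs ! i ≡ just x → P x
All-! {i = suc zero}    (px ∷ _)   refl = px
All-! {i = suc (suc i)} (_ ∷ pxs) e    = All-! pxs e

All-!-++ˡ : ∀ {P : ℕ → Set} xs {ys i x} → All P xs → i ≤ length xs → (xs ++ ys) ! i ≡ just x → P x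
All-!-++ˡ []       {[]}              _          _         ()
All-!-++ˡ []       {_ ∷ _} {zero}    _          _         ()
All-!-++ˡ (y ∷ ys) {i = suc zero}    (py ∷ _)   _         refl = py
All-!-++ˡ (y ∷ ys) {i = suc (suc i)} (_ ∷ pys) (s≤s i≤) e    = All-!-++ˡ ys pys i≤ e

All-!-++ʳ : ∀ {P : ℕ → Set} xs {ys i x} → All P ys → length xs < i → (xs ++ ys) ! i ≡ just x → P x
All-!-++ʳ []       pys _ e = All-! pys e
All-!-++ʳ (y ∷ ys) {i = suc (suc i)} pys (s≤s l<i) e = All-!-++ʳ ys pys l<i e

record Split (P Q : ℕ → Set) (xs : List ℕ) : Set where
  constructor split
  field
    front back : List ℕ
    splits : xs ≡ front ++ back
    All-front : All P front
    All-back : All Q back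

open Split

decreasing⇒All≤head : ∀ {x xs} → Linked _≥_ (x ∷ xs) → All (_≤ x) (x ∷ xs)
decreasing⇒All≤head = Linked⇒All (λ y≤x z≤y → ≤-trans z≤y y≤x) ≤-refl

All≤first : ∀ {xs x} → xs ! 1 ≡ just x → Linked _≥_ xs → All (_≤ x) xs
All≤first {_ ∷ _} refl = decreasing⇒All≤head

decreasing⇒All<head : ∀ {y g} → Linked _>_ (y ∷ g) → All (_< y) g
decreasing⇒All<head [-]       = []
decreasing⇒All<head (z<y ∷ l) = Linked⇒All (λ y<x z<y → <-trans z<y y<x) z<y l

maxRun : ∀ {v} xs → All (_≤ v) xs → Linked _≥_ xs → Split (_≡ v) (_< v) xs
maxRun []       _            _ = split [] [] refl [] []
maxRun {v} (x ∷ xs) (x≤v ∷ xs≤v) l with x ≟ v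
... | no x≢v = split [] (x ∷ xs) refl [] (All.map (λ y≤x → ≤-<-trans y≤x (≤∧≢⇒< x≤v x≢v)) (decreasing⇒All≤head l))
... | yes x≡v with maxRun xs xs≤v (Linked.tail l)
...   | split pre rest refl pre≡v rest<v = split (x ∷ pre) rest refl (x≡v ∷ pre≡v) rest<v

minRun : ∀ {v} xs → All (v ≤_) xs → Linked _≥_ xs → Split (v <_) (_≡ v) xs
minRun []       _            _ = split [] [] refl [] []
minRun {v} (x ∷ xs) (v≤x ∷ v≤xs) l with v ≟ x
... | yes refl = split [] (x ∷ xs) refl [] (All.zipWith (λ (y≤v , v≤y) → ≤-antisym y≤v v≤y) (decreasing⇒All≤head l , v≤x ∷ v≤xs))
... | no v≢x with minRun xs v≤xs (Linked.tail l)
...   | split A post refl v<A post≡v = split (x ∷ A) post refl (≤∧≢⇒< v≤x v≢x ∷ v<A) post≡v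

StartsWithRun : ℕ → List ℕ → ℕ → Set
StartsWithRun v xs p = (∀ i x → i ≤ p → xs ! i ≡ just x → x ≡ v) × (Σ ℕ λ x → (xs ! suc p ≡ just x) × (x < v))

prefixRun⇔ : ∀ {v xs} (s : Split (_≡ v) (_< v) xs) p → p < length xs → StartsWithRun v xs p ⇔ length (front s) ≡ p
prefixRun⇔ {v} (split pre rest refl pre≡v rest<v) p p<len = mk⇔ run⇒length length⇒run
  where
  c : ℕ
  c = length pre
  run⇒length : StartsWithRun v (pre ++ rest) p → c ≡ p
  run⇒length (before , x , x∈ , x<v) with <-cmp c p
  ... | tri≈ _ c≡p _ = c≡p
  ... | tri> _ _ p<c = contradiction (All-!-++ˡ pre pre≡v p<c x∈) (<⇒≢ x<v)
  ... | tri< c<p _ _ with !-defined (pre ++ rest) (s≤s z≤n) (≤-trans c<p (<⇒≤ (!-just⇒≤length (pre ++ rest) x∈)))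
  ...   | z , z∈ = contradiction (before (suc c) z c<p z∈) (<⇒≢ (All-!-++ʳ pre rest<v (n<1+n c) z∈))
  length⇒run : c ≡ p → StartsWithRun v (pre ++ rest) p
  length⇒run refl with !-defined (pre ++ rest) (s≤s z≤n) p<len
  ... | x , x∈ = (λ i x → All-!-++ˡ pre pre≡v) , x , x∈ , All-!-++ʳ pre rest<v (n<1+n c) x∈

startsWithRun-zero⇔ : ∀ {v} xs → StartsWithRun v xs 0 ⇔ (Σ ℕ λ x → (xs ! 1 ≡ just x) × (x < v))
startsWithRun-zero⇔ xs = mk⇔ proj₂ ((λ { zero x _ e → contradiction e (!-zero xs) }) ,_)

allEqual⇔ : ∀ {v xs} (s : Split (_≡ v) (_< v) xs) → All (_≡ v) xs ⇔ length (front s) ≡ length xs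
allEqual⇔ (split pre []       refl pre≡v [])        =
  mk⇔ (λ _ → sym (trans (length-++ pre) (+-identityʳ _))) (λ _ → ++⁺ pre≡v [])
allEqual⇔ (split pre (z ∷ zs) refl pre≡v (z<v ∷ _)) =
  mk⇔ (λ all≡v → contradiction (All.head (++⁻ʳ pre all≡v)) (<⇒≢ z<v))
      (λ eq → contradiction (sym (trans eq (length-++ pre))) (m+1+n≢m _))

-- Entry length xs + 1 − p is the last one above v; all later entries equal v.
EndsWithRun : ℕ → List ℕ → ℕ → Set
EndsWithRun v xs p = (∀ i x → length xs + 1 < i + p → xs ! i ≡ just x → x ≡ v)
  × (Σ ℕ λ j → Σ ℕ λ x → (j + p ≡ length xs + 1) × (xs ! j ≡ just x) × (v < x))

module _ {v : ℕ} {A post : List ℕ} (v<A : All (v <_) A) (post≡v : All (_≡ v) post) where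

  above⇒inFront : ∀ {j x} → (A ++ post) ! j ≡ just x → v < x → j ≤ length A
  above⇒inFront x∈ v<x = ≮⇒≥ (λ L<j → <⇒≢ v<x (sym (All-!-++ʳ A post≡v L<j x∈)))

  lastOfFront : 0 < length A → Σ ℕ λ z → ((A ++ post) ! length A ≡ just z) × (v < z)
  lastOfFront 0<L with !-defined (A ++ post) 0<L (length-++-≤ˡ A)
  ... | z , z∈ = z , z∈ , All-!-++ˡ A v<A ≤-refl z∈

suffixRun⇔ : ∀ {v xs} (s : Split (v <_) (_≡ v) xs) → 0 < length (front s) → ∀ p →
  EndsWithRun v xs p ⇔ suc (length (back s)) ≡ p
suffixRun⇔ {v} (split A post refl v<A post≡v) 0<L p with lastOfFront v<A post≡v 0<L
... | z , z∈ , v<z = mk⇔ run⇒length length⇒run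
  where
  L q : ℕ
  L = length A
  q = length post
  len+1≡ : length (A ++ post) + 1 ≡ L + suc q
  len+1≡ = trans (cong (_+ 1) (length-++ A)) (trans (+-assoc L q 1) (cong (L +_) (+-comm q 1)))
  run⇒length : EndsWithRun v (A ++ post) p → suc q ≡ p
  run⇒length (after , j , x , j+p≡ , x∈ , v<x) = ≤-antisym (+-cancelˡ-≤ L (suc q) p L+1+q≤L+p) p≤1+q
    where
    open ≤-Reasoning
    L+1+q≤L+p : L + suc q ≤ L + p
    L+1+q≤L+p = begin
      L + suc q                ≡⟨ sym len+1≡ ⟩
      length (A ++ post) + 1   ≡⟨ sym j+p≡ ⟩
      j + p                    ≤⟨ +-monoˡ-≤ p (above⇒inFront v<A post≡v x∈ v<x) ⟩
      L + p                    ∎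
    p≤1+q : p ≤ suc q
    p≤1+q = ≮⇒≥ (λ 1+q<p → <⇒≢ v<z (sym (after L z (subst (_< L + p) (sym len+1≡) (+-monoʳ-< L 1+q<p)) z∈)))
  length⇒run : suc q ≡ p → EndsWithRun v (A ++ post) p
  length⇒run refl =
    (λ i x len+1<i+p → All-!-++ʳ A post≡v (+-cancelʳ-< (suc q) L i (subst (_< i + suc q) len+1≡ len+1<i+p)))
    , L , z , sym len+1≡ , z∈ , v<z

lastAbove⇔ : ∀ {v xs} (s : Split (v <_) (_≡ v) xs) → 0 < length (front s) →
  (Σ ℕ λ x → (xs ! length xs ≡ just x) × (v < x)) ⇔ suc (length (back s)) ≡ 1
lastAbove⇔ {v} (split A [] refl v<A _) 0<L =
  mk⇔ (λ _ → refl) (λ _ → subst AboveAt (cong length (sym (++-identityʳ A))) (lastOfFront v<A [] 0<L))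
  where
  AboveAt : ℕ → Set
  AboveAt i = Σ ℕ λ z → ((A ++ []) ! i ≡ just z) × (v < z)
lastAbove⇔ (split A (z ∷ zs) refl v<A post≡v) _ =
  mk⇔ (λ (x , x∈ , v<x) → contradiction (above⇒inFront v<A post≡v x∈ v<x) (<⇒≱ L<len)) (λ ())
  where
  L<len : length A < length (A ++ z ∷ zs)
  L<len = subst (length A <_) (sym (length-++-sucʳ A z zs)) (s≤s (length-++-≤ˡ A))

-- The j-th entry is at least k + j; NoSpecialPart is the case k = 0.
NoSpecialPartFrom : ℕ → List ℕ → Set
NoSpecialPartFrom k []       = ⊤
NoSpecialPartFrom k (x ∷ xs) = k < x × NoSpecialPartFrom (suc k) xs

noSpecialPartFrom : ∀ k xs → (∀ j x → xs ! j ≡ just x → k + j ≤ x) → NoSpecialPartFrom k xs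
noSpecialPartFrom k []       _ = tt
noSpecialPartFrom k (x ∷ xs) h =
  subst (_≤ x) (+-comm k 1) (h 1 x refl) ,
  noSpecialPartFrom (suc k) xs (λ j y y∈ → subst (_≤ y) (+-suc k j) (h (suc j) y (!-∷ xs y∈)))

noSpecialPartFrom-++ : ∀ k xs {ys} → NoSpecialPartFrom k (xs ++ ys) → NoSpecialPartFrom (k + length xs) ys
noSpecialPartFrom-++ k []       nsp rewrite +-identityʳ k = nsp
noSpecialPartFrom-++ k (x ∷ xs) (_ , nsp) rewrite +-suc k (length xs) = noSpecialPartFrom-++ (suc k) xs nsp

noSpecialPartFrom⇒All≥ : ∀ {k} xs → Linked _≥_ xs → NoSpecialPartFrom k xs → All (k + length xs ≤_) xs
noSpecialPartFrom⇒All≥         []           _           _         = []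
noSpecialPartFrom⇒All≥ {k}     (x ∷ [])     _           (k<x , _) = subst (_≤ x) (sym (+-comm k 1)) k<x ∷ []
noSpecialPartFrom⇒All≥ {k} (x ∷ y ∷ ys) (y≤x ∷ l) (_ , nsp)
  rewrite +-suc k (length (y ∷ ys)) with noSpecialPartFrom⇒All≥ (y ∷ ys) l nsp
... | bound≤y ∷ bound≤ys = ≤-trans bound≤y y≤x ∷ bound≤y ∷ bound≤ys

length-gammaFrom : ∀ k xs → length (gammaFrom k xs) ≡ length xs
length-gammaFrom k []       = refl
length-gammaFrom k (x ∷ xs) = cong suc (length-gammaFrom (suc k) xs)

gammaFrom-++ : ∀ k xs ys → gammaFrom k (xs ++ ys) ≡ gammaFrom k xs ++ gammaFrom (k + length xs) ys
gammaFrom-++ k []       ys rewrite +-identityʳ k = refl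
gammaFrom-++ k (x ∷ xs) ys rewrite +-suc k (length xs) = cong ((x ∸ k) ∷_) (gammaFrom-++ (suc k) xs ys)

gammaFrom-decreasing : ∀ {k} xs → Linked _≥_ xs → NoSpecialPartFrom k xs → Linked _>_ (gammaFrom k xs)
gammaFrom-decreasing         []           _         _ = []
gammaFrom-decreasing         (x ∷ [])     _         _ = [-]
gammaFrom-decreasing {k} (x ∷ y ∷ ys) (y≤x ∷ l) (_ , 1+k<y , nsp) =
  <-≤-trans (∸-monoʳ-< (n<1+n k) (<⇒≤ 1+k<y)) (∸-monoˡ-≤ k y≤x)
  ∷ gammaFrom-decreasing (y ∷ ys) l (1+k<y , nsp)

gammaFrom-positive : ∀ {k} xs → NoSpecialPartFrom k xs → All (0 <_) (gammaFrom k xs)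
gammaFrom-positive []       _           = []
gammaFrom-positive (x ∷ xs) (k<x , nsp) = m<n⇒0<n∸m k<x ∷ gammaFrom-positive xs nsp

gammaFrom-≤ : ∀ {v k} xs → All (_≤ v) xs → All (_≤ v) (gammaFrom k xs)
gammaFrom-≤         []       []           = []
gammaFrom-≤ {k = k} (x ∷ xs) (x≤v ∷ xs≤v) = ≤-trans (m∸n≤m x k) x≤v ∷ gammaFrom-≤ xs xs≤v

gammaFrom-< : ∀ {v k} xs → All (_< v) xs → NoSpecialPartFrom k xs → All (_< v ∸ k) (gammaFrom k xs)
gammaFrom-<         []       []           _           = []
gammaFrom-< {v} {k} (x ∷ xs) (x<v ∷ xs<v) (k<x , nsp) =
  ∸-monoˡ-< x<v (<⇒≤ k<x) ∷ All.map (λ y< → <-≤-trans y< (∸-monoʳ-≤ v (n≤1+n k))) (gammaFrom-< xs xs<v nsp)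

gammaFrom-> : ∀ {d} k xs → All (k + length xs + d ≤_) xs → All (d <_) (gammaFrom k xs)
gammaFrom->         k []       []             = []
gammaFrom-> {d} k (x ∷ xs) (bound≤x ∷ bound≤xs) =
  <-≤-trans (s≤s (m≤n+m d L)) (m+n≤o⇒m≤o∸n (suc L + d) (subst (_≤ x) reorder bound≤x))
  ∷ gammaFrom-> (suc k) xs (All.map (λ {y} → subst (_≤ y) (cong (_+ d) (+-suc k L))) bound≤xs)
  where
  L : ℕ
  L = length xs
  reorder : k + suc L + d ≡ suc L + d + k
  reorder = trans (+-assoc k (suc L) d) (+-comm k (suc L + d))

down : ℕ → List ℕ
down k = map suc (downFrom k)

downAbove : ℕ → ℕ → List ℕ
downAbove r c = map (λ i → r + suc i) (downFrom c)

down-split : ∀ c r → down (c + r) ≡ downAbove r c ++ down r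
down-split zero    r = refl
down-split (suc c) r = cong₂ _∷_ (trans (cong suc (+-comm c r)) (sym (+-suc r c))) (down-split c r)

down-bounded : ∀ k → All (_≤ k) (down k)
down-bounded k = All.tabulate λ y∈ → bound (∈-map⁻ suc y∈)
  where
  bound : ∀ {y} → Σ ℕ (λ i → i ∈ downFrom k × y ≡ suc i) → y ≤ k
  bound (i , i∈ , refl) = ∈-downFrom⁻ i∈

downAbove-above : ∀ r c → All (r <_) (downAbove r c)
downAbove-above r zero    = []
downAbove-above r (suc c) = m<m+n r (s≤s z≤n) ∷ downAbove-above r c

gammaFrom-run : ∀ {v} k xs r → All (_≡ v) xs → k + length xs + r ≡ v → gammaFrom k xs ≡ downAbove r (length xs)
gammaFrom-run k []       r []           _  = refl
gammaFrom-run k (x ∷ xs) r (refl ∷ xs≡x) eq =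
  cong₂ _∷_ head (gammaFrom-run (suc k) xs r xs≡x (trans (cong (_+ r) (sym (+-suc k L))) eq))
  where
  open ≡-Reasoning
  L : ℕ
  L = length xs
  head : x ∸ k ≡ r + suc L
  head = begin
    x ∸ k                ≡⟨ cong (_∸ k) (sym eq) ⟩
    k + suc L + r ∸ k    ≡⟨ cong (_∸ k) (+-assoc k (suc L) r) ⟩
    k + (suc L + r) ∸ k  ≡⟨ m+n∸m≡n k (suc L + r) ⟩
    suc L + r            ≡⟨ +-comm (suc L) r ⟩
    r + suc L            ∎

complement : ℕ → List ℕ → List ℕ
complement k g = filter (_∉? g) (down k)

filter-∉-∷ : ∀ {y} g xs → y ∉ xs → filter (_∉? (y ∷ g)) xs ≡ filter (_∉? g) xs
filter-∉-∷ g []       _  = refl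
filter-∉-∷ {y} g (x ∷ xs) y∉ = by-cases (x ∈? g)
  where
  open ≡-Reasoning
  ih : filter (_∉? (y ∷ g)) xs ≡ filter (_∉? g) xs
  ih = filter-∉-∷ g xs (y∉ ∘ there)
  by-cases : Dec (x ∈ g) → filter (_∉? (y ∷ g)) (x ∷ xs) ≡ filter (_∉? g) (x ∷ xs)
  by-cases (yes x∈g) = begin
    filter (_∉? (y ∷ g)) (x ∷ xs) ≡⟨ filter-reject (_∉? (y ∷ g)) (λ x∉ → x∉ (there x∈g)) ⟩
    filter (_∉? (y ∷ g)) xs       ≡⟨ ih ⟩
    filter (_∉? g) xs             ≡⟨ filter-reject (_∉? g) (λ x∉ → x∉ x∈g) ⟨
    filter (_∉? g) (x ∷ xs)       ∎
  by-cases (no x∉g) = begin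
    filter (_∉? (y ∷ g)) (x ∷ xs) ≡⟨ filter-accept (_∉? (y ∷ g)) x∉y∷g ⟩
    x ∷ filter (_∉? (y ∷ g)) xs   ≡⟨ cong (x ∷_) ih ⟩
    x ∷ filter (_∉? g) xs         ≡⟨ filter-accept (_∉? g) x∉g ⟨
    filter (_∉? g) (x ∷ xs)       ∎
    where
    x∉y∷g : x ∉ y ∷ g
    x∉y∷g (here refl) = y∉ (here refl)
    x∉y∷g (there x∈g) = x∉g x∈g

complement-length : ∀ k g → Linked _>_ g → All (0 <_) g → All (_≤ k) g → length (complement k g) + length g ≡ k
complement-length zero    []      _ _         _           = refl
complement-length zero    (y ∷ g) _ (0<y ∷ _) (y≤0 ∷ _)   = contradiction y≤0 (<⇒≱ 0<y)
complement-length (suc k) []      _ _         _           = cong suc (complement-length k [] [] [] [])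
complement-length (suc k) (y ∷ g) l (0<y ∷ 0<g) (y≤1+k ∷ _) with m≤n⇒m<n∨m≡n y≤1+k
... | inj₂ refl = begin
  length (complement (suc k) (suc k ∷ g)) + suc (length g) ≡⟨ cong (λ xs → length xs + suc (length g)) drop-top ⟩
  length (complement k g) + suc (length g)                 ≡⟨ +-suc _ (length g) ⟩
  suc (length (complement k g) + length g)                 ≡⟨ cong suc (complement-length k g (Linked.tail l) 0<g g≤k) ⟩
  suc k                                                    ∎
  where
  open ≡-Reasoning
  drop-top : complement (suc k) (suc k ∷ g) ≡ complement k g
  drop-top = trans (filter-reject (_∉? (suc k ∷ g)) (λ ∉ → ∉ (here refl)))
                   (filter-∉-∷ g (down k) (λ ∈ → 1+n≰n (All.lookup (down-bounded k) ∈)))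
  g≤k : All (_≤ k) g
  g≤k = All.map s≤s⁻¹ (decreasing⇒All<head l)
... | inj₁ y<1+k = trans (cong (λ xs → length xs + length (y ∷ g)) keep-top)
                         (cong suc (complement-length k (y ∷ g) l (0<y ∷ 0<g) y∷g≤k))
  where
  y∷g≤k : All (_≤ k) (y ∷ g)
  y∷g≤k = s≤s⁻¹ y<1+k ∷ All.map (λ z<y → ≤-trans (<⇒≤ z<y) (s≤s⁻¹ y<1+k)) (decreasing⇒All<head l)
  keep-top : complement (suc k) (y ∷ g) ≡ suc k ∷ complement k (y ∷ g)
  keep-top = filter-accept (_∉? (y ∷ g)) (λ ∈ → 1+n≰n (All.lookup y∷g≤k ∈))

complement-split : ∀ c r g → complement (c + r) g ≡ filter (_∉? g) (downAbove r c) ++ complement r g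
complement-split c r g = trans (cong (filter (_∉? g)) (down-split c r)) (filter-++ (_∉? g) (downAbove r c) (down r))

filter-∉-none : ∀ {g} xs → All (_∈ g) xs → filter (_∉? g) xs ≡ []
filter-∉-none xs xs⊆g = filter-none (_∉? _) (All.map (λ x∈ x∉ → x∉ x∈) xs⊆g)

∉-between : ∀ {y} xs ys → All (y <_) xs → All (_< y) ys → y ∉ xs ++ ys
∉-between xs ys y<xs ys<y y∈ with ∈-++⁻ xs y∈
... | inj₁ y∈xs = <-irrefl refl (All.lookup y<xs y∈xs)
... | inj₂ y∈ys = <-irrefl refl (All.lookup ys<y y∈ys)

complement-head : ∀ c r G → 0 < r → All (_< r) G → complement (c + r) (downAbove r c ++ G) ! 1 ≡ just r
complement-head c (suc r) G _ G<1+r = begin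
  complement (c + suc r) g ! 1                                      ≡⟨ cong (_! 1) (complement-split c (suc r) g) ⟩
  (filter (_∉? g) (downAbove (suc r) c) ++ complement (suc r) g) ! 1 ≡⟨ cong (λ xs → (xs ++ complement (suc r) g) ! 1) high-removed ⟩
  complement (suc r) g ! 1                                          ≡⟨ cong (_! 1) (filter-accept (_∉? g) 1+r∉g) ⟩
  just (suc r)                                                      ∎
  where
  open ≡-Reasoning
  g : List ℕ
  g = downAbove (suc r) c ++ G
  high-removed : filter (_∉? g) (downAbove (suc r) c) ≡ []
  high-removed = filter-∉-none (downAbove (suc r) c) (All.tabulate ∈-++⁺ˡ)
  1+r∉g : suc r ∉ g
  1+r∉g = ∉-between (downAbove (suc r) c) G (downAbove-above (suc r) c) G<1+r

complement-last : ∀ t q G → All (suc q <_) G →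
  complement (t + suc q) (G ++ down q) ≡ filter (_∉? (G ++ down q)) (downAbove (suc q) t) ++ suc q ∷ []
complement-last t q G 1+q<G = begin
  complement (t + suc q) g                                  ≡⟨ complement-split t (suc q) g ⟩
  filter (_∉? g) (downAbove (suc q) t) ++ complement (suc q) g ≡⟨ cong (filter (_∉? g) (downAbove (suc q) t) ++_) last-kept ⟩
  filter (_∉? g) (downAbove (suc q) t) ++ suc q ∷ []         ∎
  where
  open ≡-Reasoning
  g : List ℕ
  g = G ++ down q
  last-kept : complement (suc q) g ≡ suc q ∷ []
  last-kept = trans (filter-accept (_∉? g) (∉-between G (down q) 1+q<G (All.map s≤s (down-bounded q))))
                    (cong (suc q ∷_) (filter-∉-none (down q) (All.tabulate (∈-++⁺ʳ G))))

module _ {n : ℕ} {a : List ℕ} (dpp : OneRowDPP n a) where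
  open OneRowDPP dpp

  All≤order : All (_≤ n) a
  All≤order with first
  ... | _ , a₁≡ , a₁≤n , _ = All.map (λ x≤a₁ → ≤-trans x≤a₁ a₁≤n) (All≤first a₁≡ weaklyDecr)

  length<order : length a < n
  length<order with first
  ... | _ , _ , a₁≤n , m<a₁ = <-≤-trans m<a₁ a₁≤n

  length>0 : 0 < length a
  length>0 with first
  ... | _ , a₁≡ , _ = !-just⇒≤length a a₁≡

  module _ (nsp : NoSpecialPart a) where

    noSpecialPartFrom0 : NoSpecialPartFrom 0 a
    noSpecialPartFrom0 = noSpecialPartFrom 0 a nsp

    length-beta : length (beta n a) ≡ n ∸ length a
    length-beta = begin
      length (beta n a)                               ≡⟨ m+n∸n≡m _ (length a) ⟨
      length (beta n a) + length a ∸ length a         ≡⟨ cong (λ k → length (beta n a) + k ∸ length a) (length-gammaFrom 0 a) ⟨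
      length (beta n a) + length (gamma a) ∸ length a ≡⟨ cong (_∸ length a) (complement-length n (gamma a) γ-decreasing γ-positive γ-bounded) ⟩
      n ∸ length a                                    ∎
      where
      open ≡-Reasoning
      γ-decreasing : Linked _>_ (gamma a)
      γ-decreasing = gammaFrom-decreasing a weaklyDecr noSpecialPartFrom0
      γ-positive : All (0 <_) (gamma a)
      γ-positive = gammaFrom-positive a noSpecialPartFrom0
      γ-bounded : All (_≤ n) (gamma a)
      γ-bounded = gammaFrom-≤ a All≤order

    beta-first-entry : Σ (Split (_≡ n) (_< n) a) λ s → ∀ p → p ≤ n → (beta n a ! 1 ≡ just (n ∸ p) ⇔ length (front s) ≡ p)
    beta-first-entry with maxRun a All≤order weaklyDecr
    ... | s@(split pre rest a≡ pre≡n rest<n) =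
      s , λ p p≤n → mk⇔ (λ β₁≡ → ∸-cancelˡ-≡ (<⇒≤ c<n) p≤n (just-injective (trans (sym β₁≡n∸c) β₁≡))) λ { refl → β₁≡n∸c }
      where
      open ≡-Reasoning
      c : ℕ
      c = length pre
      c<n : c < n
      c<n = ≤-<-trans (subst (c ≤_) (cong length (sym a≡)) (length-++-≤ˡ pre)) length<order
      γ≡ : gamma a ≡ downAbove (n ∸ c) c ++ gammaFrom c rest
      γ≡ = trans (cong gamma a≡) (trans (gammaFrom-++ 0 pre rest)
             (cong (_++ gammaFrom c rest) (gammaFrom-run 0 pre (n ∸ c) pre≡n (m+[n∸m]≡n (<⇒≤ c<n)))))
      rest-small : All (_< n ∸ c) (gammaFrom c rest)
      rest-small = gammaFrom-< rest rest<n (noSpecialPartFrom-++ 0 pre (subst (NoSpecialPartFrom 0) a≡ noSpecialPartFrom0))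
      β₁≡n∸c : beta n a ! 1 ≡ just (n ∸ c)
      β₁≡n∸c = begin
        beta n a ! 1                     ≡⟨ cong (λ g → complement n g ! 1) γ≡ ⟩
        complement n g ! 1               ≡⟨ cong (λ k → complement k g ! 1) (m+[n∸m]≡n (<⇒≤ c<n)) ⟨
        complement (c + (n ∸ c)) g ! 1   ≡⟨ complement-head c (n ∸ c) (gammaFrom c rest) (m<n⇒0<n∸m c<n) rest-small ⟩
        just (n ∸ c)                     ∎
        where
        g : List ℕ
        g = downAbove (n ∸ c) c ++ gammaFrom c rest

    beta-last-entry : Σ (Split (length a <_) (_≡ length a) a) λ s → 0 < length (front s)
      × (∀ p → beta n a ! (n ∸ length a) ≡ just p ⇔ suc (length (back s)) ≡ p)
    beta-last-entry with minRun a (noSpecialPartFrom⇒All≥ a weaklyDecr noSpecialPartFrom0) weaklyDecr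
    ... | s@(split A post a≡ m<A post≡m) = s , 0<L , λ p → just-≡⇔ βₘ≡1+q
      where
      open ≡-Reasoning
      m L q : ℕ
      m = length a
      L = length A
      q = length post
      m≡L+q : m ≡ L + q
      m≡L+q = trans (cong length a≡) (length-++ A)
      0<L : 0 < L
      0<L with first
      ... | a₁ , a₁≡ , _ , m<a₁ = ≮⇒≥ λ L<1 → <⇒≢ m<a₁ (sym (All-!-++ʳ A post≡m L<1 (subst (λ xs → xs ! 1 ≡ just a₁) a≡ a₁≡)))
      γ≡ : gamma a ≡ gammaFrom 0 A ++ down q
      γ≡ = trans (cong gamma a≡) (trans (gammaFrom-++ 0 A post)
             (cong (gammaFrom 0 A ++_) (gammaFrom-run L post 0 post≡m (trans (+-identityʳ _) (sym m≡L+q)))))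
      front-large : All (suc q <_) (gammaFrom 0 A)
      front-large = gammaFrom-> 0 A (All.map (λ {x} → subst (_≤ x) (trans (cong suc m≡L+q) (sym (+-suc L q)))) m<A)
      1+q≤n : suc q ≤ n
      1+q≤n = ≤-trans (s≤s (subst (q ≤_) (sym m≡L+q) (m≤n+m q L))) length<order
      B : List ℕ
      B = filter (_∉? (gammaFrom 0 A ++ down q)) (downAbove (suc q) (n ∸ suc q))
      β≡ : beta n a ≡ B ++ suc q ∷ []
      β≡ = begin
        beta n a                                                 ≡⟨ cong (complement n) γ≡ ⟩
        complement n (gammaFrom 0 A ++ down q)                   ≡⟨ cong (λ k → complement k (gammaFrom 0 A ++ down q)) (m∸n+n≡m 1+q≤n) ⟨
        complement (n ∸ suc q + suc q) (gammaFrom 0 A ++ down q) ≡⟨ complement-last (n ∸ suc q) q (gammaFrom 0 A) front-large ⟩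
        B ++ suc q ∷ []                                          ∎
      βₘ≡1+q : beta n a ! (n ∸ m) ≡ just (suc q)
      βₘ≡1+q = begin
        beta n a ! (n ∸ m)                           ≡⟨ cong (beta n a !_) length-beta ⟨
        beta n a ! length (beta n a)                 ≡⟨ cong (λ xs → xs ! length xs) β≡ ⟩
        (B ++ suc q ∷ []) ! length (B ++ suc q ∷ []) ≡⟨ !-last B (suc q) ⟩
        just (suc q)                                 ∎

lemma3p3 : (n : ℕ) (a : List ℕ) → OneRowDPP n a → NoSpecialPart a →
    ((beta n a ! (n ∸ length a) ≡ just 1
        ⇔ (Σ ℕ λ x → (a ! length a ≡ just x) × (length a < x)))
     × (∀ p → 1 < p → p < n →
          (beta n a ! (n ∸ length a) ≡ just p
            ⇔ ((∀ i x → length a + 1 < i + p → a ! i ≡ just x → x ≡ length a)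
               × (Σ ℕ λ j → Σ ℕ λ x → (j + p ≡ length a + 1) × (a ! j ≡ just x) × (length a < x))))))
    × ((beta n a ! 1 ≡ just n ⇔ (Σ ℕ λ x → (a ! 1 ≡ just x) × (x < n)))
       × (∀ p → 0 < p → p < length a →
            (beta n a ! 1 ≡ just (n ∸ p)
              ⇔ ((∀ i x → i ≤ p → a ! i ≡ just x → x ≡ n)
                 × (Σ ℕ λ x → (a ! suc p ≡ just x) × (x < n)))))
       × (beta n a ! 1 ≡ just (n ∸ length a) ⇔ All (_≡ n) a))
lemma3p3 n a dpp nsp with beta-last-entry dpp nsp | beta-first-entry dpp nsp
... | s↑ , 0<L , last⇔ | s↓ , first⇔ =
  ( ⇔-trans (last⇔ 1) (⇔-sym (lastAbove⇔ s↑ 0<L))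
  , λ p _ _ → ⇔-trans (last⇔ p) (⇔-sym (suffixRun⇔ s↑ 0<L p)) )
  , ( ⇔-trans (first⇔ 0 z≤n) (⇔-trans (⇔-sym (prefixRun⇔ s↓ 0 (length>0 dpp))) (startsWithRun-zero⇔ a))
    , (λ p _ p<m → ⇔-trans (first⇔ p (≤-trans (<⇒≤ p<m) m≤n)) (⇔-sym (prefixRun⇔ s↓ p p<m)))
    , ⇔-trans (first⇔ (length a) m≤n) (⇔-sym (allEqual⇔ s↓)) )
  where
  m≤n : length a ≤ n
  m≤n = <⇒≤ (length<order dpp)
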